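{- Let $\alpha\in(0,1)$ be irrational with continued fraction expansion $[0;a_1,a_2,\dots]$ and continuants $q_0,q_1,\dots$. Let $m$ be a positive integer and let $q_t$ be the largest continuant that is less than or equal to $m$. Then $C_m=C_{q_t}C_{m-q_t}$.
   Context: For $\alpha\in(0,1)$ let $\mathcal{B}(\alpha)$ be the set of terms of $(\lfloor n/\alpha\rfloor)_{n=1}^\infty$; $c_k=1$ if $k\in\mathcal{B}(\alpha)$ and $c_k=0$ otherwise; $C_m$ is the binary word $c_1c_2\cdots c_m$, $C_0$ is the empty word, and juxtaposition of words is concatenation. Continuants: $q_0=1$, $q_1=a_1$, $q_i=a_iq_{i-1}+q_{i-2}$ for $i\ge2$. -}

module Defs where

open import Data.Nat using (ℕ; zero; suc; _+_; _*_; _<_; _≤_)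
open import Data.Product using (Σ; ∃; _×_)
open import Relation.Nullary using (¬_)

-- An irrational α ∈ (0,1) is given by its continued fraction [0; a 1, a 2, …]
-- with a i ≥ 1 for i ≥ 1 (the value a 0 is ignored; a₀ = 0).

q : (ℕ → ℕ) → ℕ → ℕ
q a zero = 1
q a (suc zero) = a 1
q a (suc (suc i)) = a (suc (suc i)) * q a (suc i) + q a i

p : (ℕ → ℕ) → ℕ → ℕ
p a zero = 0
p a (suc zero) = 1
p a (suc (suc i)) = a (suc (suc i)) * p a (suc i) + p a i

-- "n < k·α", where α = [0; a 1, a 2, …].  The even convergents p_{2i}/q_{2i}
-- increase strictly to α, so n < kα iff n < k·p_{2i}/q_{2i} for some i.
LtMulα : (ℕ → ℕ) → ℕ → ℕ → Set
LtMulα a n k = ∃ λ i → n * q a (2 * i) < k * p a (2 * i)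

-- ⌊ n / α ⌋ ≡ k  ⇔  k ≤ n/α < k+1  ⇔  kα ≤ n < (k+1)α   (α > 0)
FloorDivα : (ℕ → ℕ) → ℕ → ℕ → Set
FloorDivα a n k = ¬ LtMulα a n k × LtMulα a n (suc k)

-- k ∈ 𝓑(α) = { ⌊ n/α ⌋ : n ≥ 1 },  i.e. c_k = 1
InB : (ℕ → ℕ) → ℕ → Set
InB a k = ∃ λ n → 1 ≤ n × FloorDivα a n k

{-# OPTIONS --safe #-}
-- Consecutive convergents p_s/q_s and p_{s+1}/q_{s+1} of α are adjacent (they differ by
-- 1/(q_s q_{s+1})) and lie on opposite sides of α, so no fraction with denominator below
-- q_s + q_{s+1} lies strictly between them.  Hence for 0 < k < q_{s+1} the test n < kα is
-- the comparison of n/k with p_s/q_s, and that comparison is unchanged when (p_s, q_s) is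
-- added to (n, k).  So ⌊n/α⌋ = k iff ⌊(p_s + n)/α⌋ = q_s + k, which carries membership in
-- 𝓑(α) between j and q_s + j once s is chosen with q_s = q_t ≤ m < q_{s+1}.
module Submission where

open import Defs
open import Data.Nat
  using (ℕ; zero; suc; _+_; _*_; _∸_; _≤_; _<_; _<′_; <′-base; <′-step; z≤n; s≤s; _≤?_; _<?_; >-nonZero)
open import Data.Nat.Properties
open import Data.Nat.Tactic.RingSolver using (solve)
open import Data.List using ([]; _∷_)
open import Data.Product using (_×_; _,_; proj₁; ∃)
open import Data.Product.Function.NonDependent.Propositional using (_×-⇔_)
open import Data.Sum using (_⊎_; inj₁; inj₂)
open import Function using (_∘_; flip; _⇔_; mk⇔; Equivalence)
import Function.Properties.Equivalence as ⇔
open import Function.Related.TypeIsomorphisms using (¬-cong-⇔)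
open import Relation.Nullary using (¬_; yes; no; contradiction)
open import Relation.Binary using (Transitive; tri<; tri≈; tri>)
open import Relation.Binary.PropositionalEquality using (_≡_; refl; sym; cong; subst; subst₂; module ≡-Reasoning)

infix  4 _≺_ _≼_
infixl 6 _⊕_
infixr 7 _·_

-- A pair (a , b) stands for the fraction a / b.
data _≺_ : ℕ × ℕ → ℕ × ℕ → Set where
  cross< : ∀ {a b c d} → a * d < c * b → (a , b) ≺ (c , d)

data _≼_ : ℕ × ℕ → ℕ × ℕ → Set where
  cross≤ : ∀ {a b c d} → a * d ≤ c * b → (a , b) ≼ (c , d)

-- c/d − a/b = 1/(bd), as for consecutive convergents.
data Adjacent : ℕ × ℕ → ℕ × ℕ → Set where
  cross≡ : ∀ {a b c d} → c * b ≡ 1 + a * d → Adjacent (a , b) (c , d)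

_⊕_ : ℕ × ℕ → ℕ × ℕ → ℕ × ℕ
(a , b) ⊕ (c , d) = a + c , b + d

_·_ : ℕ → ℕ × ℕ → ℕ × ℕ
k · (a , b) = k * a , k * b

≼-≺-trans : ∀ {a b y z} → 1 ≤ b → (a , b) ≼ y → y ≺ z → (a , b) ≺ z
≼-≺-trans {a} {b} b≥1 (cross≤ {c = c} {d = d} ad≤cb) (cross< {c = e} {d = f} cf<ed) =
  cross< (*-cancelʳ-< d (a * f) (e * b) (begin-strict
    a * f * d ≡⟨ solve (a ∷ d ∷ f ∷ []) ⟩
    a * d * f ≤⟨ *-monoˡ-≤ f ad≤cb ⟩
    c * b * f ≡⟨ solve (b ∷ c ∷ f ∷ []) ⟩
    c * f * b <⟨ *-monoˡ-< b {{>-nonZero b≥1}} cf<ed ⟩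
    e * d * b ≡⟨ solve (b ∷ d ∷ e ∷ []) ⟩
    e * b * d ∎))
  where open ≤-Reasoning

≺-trans : Transitive _≺_
≺-trans (cross< {a} {zero} {c} {d} ad<c0) _ = contradiction (subst (a * d <_) (*-zeroʳ c) ad<c0) n≮0
≺-trans (cross< {b = suc _} ad<cb) y≺z = ≼-≺-trans (s≤s z≤n) (cross≤ (<⇒≤ ad<cb)) y≺z

stepwise⇒monotone : ∀ {A : Set} {_∼_ : A → A → Set} → Transitive _∼_ →
  (f : ℕ → A) → (∀ i → f i ∼ f (suc i)) → ∀ {i j} → i < j → f i ∼ f j
stepwise⇒monotone {_∼_ = _∼_} ∼-trans f step = go ∘ <⇒<′
  where
  go : ∀ {i j} → i <′ j → f i ∼ f j
  go <′-base         = step _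
  go (<′-step i<′j) = ∼-trans (go i<′j) (step _)

x≺k·y⊕x : ∀ {x y k} → 1 ≤ k → x ≺ y → x ≺ k · y ⊕ x
x≺k·y⊕x {k = k} k≥1 (cross< {a} {b} {c} {d} ad<cb) = cross< (begin-strict
  a * (k * d + b)     ≡⟨ solve (a ∷ b ∷ d ∷ k ∷ []) ⟩
  k * (a * d) + a * b <⟨ +-monoˡ-< (a * b) (*-monoʳ-< k {{>-nonZero k≥1}} ad<cb) ⟩
  k * (c * b) + a * b ≡⟨ solve (a ∷ b ∷ c ∷ k ∷ []) ⟩
  (k * c + a) * b     ∎)
  where open ≤-Reasoning

k·x⊕y≺y : ∀ {x y k} → 1 ≤ k → x ≺ y → k · x ⊕ y ≺ y
k·x⊕y≺y {k = k} k≥1 (cross< {a} {b} {c} {d} ad<cb) = cross< (begin-strict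
  (k * a + c) * d     ≡⟨ solve (a ∷ c ∷ d ∷ k ∷ []) ⟩
  k * (a * d) + c * d <⟨ +-monoˡ-< (c * d) (*-monoʳ-< k {{>-nonZero k≥1}} ad<cb) ⟩
  k * (c * b) + c * d ≡⟨ solve (b ∷ c ∷ d ∷ k ∷ []) ⟩
  c * (k * b + d)     ∎)
  where open ≤-Reasoning

x⊕y≼x⇔y≼x : ∀ {a b c d} → (a , b) ⊕ (c , d) ≼ (a , b) ⇔ (c , d) ≼ (a , b)
x⊕y≼x⇔y≼x {a} {b} {c} {d} = mk⇔
  (λ { (cross≤ le) → cross≤ (+-cancelˡ-≤ (a * b) _ _ (subst₂ _≤_ lhs rhs le)) })
  (λ { (cross≤ le) → cross≤ (subst₂ _≤_ (sym lhs) (sym rhs) (+-monoʳ-≤ (a * b) le)) })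
  where
  lhs : (a + c) * b ≡ a * b + c * b
  lhs = *-distribʳ-+ b a c
  rhs : a * (b + d) ≡ a * b + a * d
  rhs = *-distribˡ-+ a b d

x⊕y≺x⇔y≺x : ∀ {a b c d} → (a , b) ⊕ (c , d) ≺ (a , b) ⇔ (c , d) ≺ (a , b)
x⊕y≺x⇔y≺x {a} {b} {c} {d} = mk⇔
  (λ { (cross< lt) → cross< (+-cancelˡ-< (a * b) _ _ (subst₂ _<_ lhs rhs lt)) })
  (λ { (cross< lt) → cross< (subst₂ _<_ (sym lhs) (sym rhs) (+-monoʳ-< (a * b) lt)) })
  where
  lhs : (a + c) * b ≡ a * b + c * b
  lhs = *-distribʳ-+ b a c
  rhs : a * (b + d) ≡ a * b + a * d
  rhs = *-distribˡ-+ a b d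

Adjacent⇒≺ : ∀ {x y} → Adjacent x y → x ≺ y
Adjacent⇒≺ (cross≡ cb≡1+ad) = cross< (≤-reflexive (sym cb≡1+ad))

k·y⊕x-adjacent : ∀ {x y} k → Adjacent x y → Adjacent (k · y ⊕ x) y
k·y⊕x-adjacent k (cross≡ {a} {b} {c} {d} cb≡1+ad) = cross≡ (begin
  c * (k * d + b)         ≡⟨ solve (b ∷ c ∷ d ∷ k ∷ []) ⟩
  k * c * d + c * b       ≡⟨ cong (k * c * d +_) cb≡1+ad ⟩
  k * c * d + (1 + a * d) ≡⟨ solve (a ∷ c ∷ d ∷ k ∷ []) ⟩
  1 + (k * c + a) * d     ∎)
  where open ≡-Reasoning

k·x⊕y-adjacent : ∀ {x y} k → Adjacent x y → Adjacent x (k · x ⊕ y)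
k·x⊕y-adjacent k (cross≡ {a} {b} {c} {d} cb≡1+ad) = cross≡ (begin
  (k * a + c) * b         ≡⟨ solve (a ∷ b ∷ c ∷ k ∷ []) ⟩
  k * a * b + c * b       ≡⟨ cong (k * a * b +_) cb≡1+ad ⟩
  k * a * b + (1 + a * d) ≡⟨ solve (a ∷ b ∷ d ∷ k ∷ []) ⟩
  1 + a * (k * b + d)     ∎)
  where open ≡-Reasoning

-- b = qL (pU b − a qU) + qU (a qL − pL b), and both differences are positive.
between-adjacent⇒qL+qU≤b : ∀ {pL qL pU qU a b} → Adjacent (pL , qL) (pU , qU) →
  (pL , qL) ≺ (a , b) → (a , b) ≺ (pU , qU) → qL + qU ≤ b
between-adjacent⇒qL+qU≤b {pL} {qL} {pU} {qU} {a} {b}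
                         (cross≡ adjacent) (cross< L≺ab) (cross< ab≺U) =
  +-cancelʳ-≤ _ (qL + qU) b (begin
    qL + qU + (qL * (a * qU) + qU * (pL * b)) ≡⟨ solve (qL ∷ qU ∷ a ∷ pL ∷ b ∷ []) ⟩
    qL * (1 + a * qU) + qU * (1 + pL * b)     ≤⟨ +-mono-≤ (*-monoʳ-≤ qL ab≺U) (*-monoʳ-≤ qU L≺ab) ⟩
    qL * (pU * b) + qU * (a * qL)             ≡⟨ solve (qL ∷ qU ∷ a ∷ pU ∷ b ∷ []) ⟩
    b * (pU * qL) + qU * (a * qL)             ≡⟨ cong (λ t → b * t + qU * (a * qL)) adjacent ⟩
    b * (1 + pL * qU) + qU * (a * qL)         ≡⟨ solve (qL ∷ qU ∷ a ∷ pL ∷ b ∷ []) ⟩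
    b + (qL * (a * qU) + qU * (pL * b))       ∎)
  where open ≤-Reasoning

-- L and U bracket a cut of the fractions; Below x y means that x / y lies below the cut.
record Brackets (Below : ℕ → ℕ → Set) (L U : ℕ × ℕ) : Set where
  field
    adjacent    : Adjacent L U
    lower-below : ∀ {x y} → 1 ≤ y → (x , y) ≼ L → Below x y
    upper-above : ∀ {x y} → U ≼ (x , y) → ¬ Below x y

module _ {Below : ℕ → ℕ → Set} {pL qL pU qU : ℕ}
         (brackets : Brackets Below (pL , qL) (pU , qU)) where
  open Brackets brackets

  private
    ≺upper⇒≼lower : ∀ {x y} → y < qL + qU → (x , y) ≺ (pU , qU) → (x , y) ≼ (pL , qL)
    ≺upper⇒≼lower {x} {y} y<qL+qU xy≺U with x * qL ≤? pL * y
    ... | yes xy≼L = cross≤ xy≼L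
    ... | no  xy⋠L =
      contradiction (between-adjacent⇒qL+qU≤b adjacent (cross< (≰⇒> xy⋠L)) xy≺U) (<⇒≱ y<qL+qU)

  Below⇔≺upper : ∀ {x y} → 1 ≤ y → y < qL + qU → Below x y ⇔ (x , y) ≺ (pU , qU)
  Below⇔≺upper y≥1 y<qL+qU =
    mk⇔ (λ below → cross< (≰⇒> (λ U≼xy → upper-above (cross≤ U≼xy) below)))
        (lower-below y≥1 ∘ ≺upper⇒≼lower y<qL+qU)

  Below⇔≼lower : ∀ {x y} → 1 ≤ y → y < qL + qU → Below x y ⇔ (x , y) ≼ (pL , qL)
  Below⇔≼lower y≥1 y<qL+qU =
    mk⇔ (≺upper⇒≼lower y<qL+qU ∘ Equivalence.to (Below⇔≺upper y≥1 y<qL+qU)) (lower-below y≥1)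

  Below-shift-lower : ∀ {x y} → 1 ≤ y → y < qU → Below x y ⇔ Below (pL + x) (qL + y)
  Below-shift-lower {y = y} y≥1 y<qU =
    ⇔.trans (Below⇔≼lower y≥1 (<-≤-trans y<qU (m≤n+m qU qL)))
   (⇔.trans (⇔.sym x⊕y≼x⇔y≼x)
            (⇔.sym (Below⇔≼lower (≤-trans y≥1 (m≤n+m y qL)) (+-monoʳ-< qL y<qU))))

  Below-shift-upper : ∀ {x y} → 1 ≤ y → y < qL → Below x y ⇔ Below (pU + x) (qU + y)
  Below-shift-upper {y = y} y≥1 y<qL =
    ⇔.trans (Below⇔≺upper y≥1 (<-≤-trans y<qL (m≤m+n qL qU)))
   (⇔.trans (⇔.sym x⊕y≺x⇔y≺x)
            (⇔.sym (Below⇔≺upper (≤-trans y≥1 (m≤n+m y qU))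
                                 (<-≤-trans (+-monoʳ-< qU y<qL) (≤-reflexive (+-comm qU qL))))))

LtMulα-downward : ∀ {a n n′ k} → n′ ≤ n → LtMulα a n k → LtMulα a n′ k
LtMulα-downward {a} n′≤n (i , lt) = i , ≤-<-trans (*-monoˡ-≤ (q a (2 * i)) n′≤n) lt

parity : ∀ s → ∃ (λ i → s ≡ 2 * i) ⊎ ∃ (λ i → s ≡ 1 + 2 * i)
parity zero = inj₁ (0 , refl)
parity (suc s) with parity s
... | inj₁ (i , refl) = inj₂ (i , refl)
... | inj₂ (i , refl) = inj₁ (suc i , sym (*-suc 2 i))

module Convergents (a : ℕ → ℕ) (a-pos : ∀ i → 1 ≤ a (suc i)) where

  conv : ℕ → ℕ × ℕ
  conv s = p a s , q a s

  q-pos : ∀ s → 1 ≤ q a s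
  q-pos zero          = ≤-refl
  q-pos (suc zero)    = a-pos 0
  q-pos (suc (suc s)) = ≤-trans (q-pos s) (m≤n+m (q a s) _)

  q-increasing : ∀ s → q a (suc s) < q a (suc (suc s))
  q-increasing s = begin-strict
    q a (suc s)                           <⟨ m<m+n (q a (suc s)) (q-pos s) ⟩
    q a (suc s) + q a s                   ≤⟨ +-monoˡ-≤ (q a s) (m≤n*m _ _ {{>-nonZero (a-pos (suc s))}}) ⟩
    a (suc (suc s)) * q a (suc s) + q a s ∎
    where open ≤-Reasoning

  E O : ℕ → ℕ × ℕ
  E i = conv (2 * i)
  O i = conv (1 + 2 * i)

  even-suc : ∀ (P : ℕ → Set) i → P (2 + 2 * i) → P (2 * suc i)
  even-suc P i = subst P (sym (*-suc 2 i))

  adjacent-even : ∀ i → Adjacent (E i) (O i)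
  adjacent-odd  : ∀ i → Adjacent (conv (2 + 2 * i)) (O i)
  adjacent-even zero    = cross≡ refl
  adjacent-even (suc i) = even-suc (λ n → Adjacent (conv n) (conv (suc n))) i
    (k·x⊕y-adjacent (a _) (adjacent-odd i))
  adjacent-odd i = k·y⊕x-adjacent (a _) (adjacent-even i)

  E-step : ∀ i → E i ≺ E (suc i)
  E-step i = even-suc (λ n → E i ≺ conv n) i
    (x≺k·y⊕x (a-pos _) (Adjacent⇒≺ (adjacent-even i)))

  O-step : ∀ i → O (suc i) ≺ O i
  O-step i = even-suc (λ n → conv (suc n) ≺ O i) i
    (k·x⊕y≺y (a-pos _) (Adjacent⇒≺ (adjacent-odd i)))

  E-ascending : ∀ {i j} → i < j → E i ≺ E j
  E-ascending = stepwise⇒monotone {_∼_ = _≺_} ≺-trans E E-step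

  O-descending : ∀ {i j} → i < j → O j ≺ O i
  O-descending = stepwise⇒monotone {_∼_ = flip _≺_} (flip ≺-trans) O O-step

  E≺O : ∀ i j → E i ≺ O j
  E≺O i j with <-cmp i j
  ... | tri< i<j _ _  = ≺-trans (E-ascending i<j) (Adjacent⇒≺ (adjacent-even j))
  ... | tri≈ _ refl _ = Adjacent⇒≺ (adjacent-even i)
  ... | tri> _ _ j<i  = ≺-trans (Adjacent⇒≺ (adjacent-even i)) (O-descending j<i)

  LtMulα⇔≺E : ∀ {x y} → LtMulα a x y ⇔ ∃ λ i → (x , y) ≺ E i
  LtMulα⇔≺E {x} {y} = mk⇔
    (λ (i , lt) → i , cross< (subst (x * q a (2 * i) <_) (*-comm y (p a (2 * i))) lt))
    (λ { (i , cross< lt) → i , subst (x * q a (2 * i) <_) (*-comm (p a (2 * i)) y) lt })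

  below-α : ∀ i {x y} → 1 ≤ y → (x , y) ≼ E i → LtMulα a x y
  below-α i y≥1 xy≼Eᵢ = Equivalence.from LtMulα⇔≺E (suc i , ≼-≺-trans y≥1 xy≼Eᵢ (E-step i))

  above-α : ∀ j {x y} → O j ≼ (x , y) → ¬ LtMulα a x y
  above-α j {x} {y} (cross≤ Oⱼ≼xy) x<yα with Equivalence.to (LtMulα⇔≺E {x} {y}) x<yα
  ... | i , xy≺Eᵢ with ≺-trans xy≺Eᵢ (E≺O i j)
  ... | cross< xy≺Oⱼ = <⇒≱ xy≺Oⱼ Oⱼ≼xy

  LtMulα-zero : ∀ {k} → 1 ≤ k → LtMulα a 0 k
  LtMulα-zero {k} k≥1 = below-α 0 {0} {k} k≥1 (cross≤ z≤n)

  brackets-even : ∀ i → Brackets (LtMulα a) (E i) (O i)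
  brackets-even i = record
    { adjacent = adjacent-even i ; lower-below = below-α i ; upper-above = above-α i }

  brackets-odd : ∀ i → Brackets (LtMulα a) (E (suc i)) (O i)
  brackets-odd i = record
    { adjacent    = even-suc (λ n → Adjacent (conv n) (O i)) i (adjacent-odd i)
    ; lower-below = below-α (suc i)
    ; upper-above = above-α i
    }

  brackets : ∀ s → Brackets (LtMulα a) (conv s) (conv (suc s))
                  ⊎ Brackets (LtMulα a) (conv (suc s)) (conv s)
  brackets s with parity s
  ... | inj₁ (i , refl) = inj₁ (brackets-even i)
  ... | inj₂ (i , refl) =
    inj₂ (subst (λ L → Brackets (LtMulα a) L (O i)) (cong conv (*-suc 2 i)) (brackets-odd i))

  LtMulα-shift : ∀ s {n k} → 1 ≤ k → k < q a (suc s) →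
    LtMulα a n k ⇔ LtMulα a (p a s + n) (q a s + k)
  LtMulα-shift s k≥1 k<qₛ₊₁ with brackets s
  ... | inj₁ b = Below-shift-lower b k≥1 k<qₛ₊₁
  ... | inj₂ b = Below-shift-upper b k≥1 k<qₛ₊₁

  FloorDivα-shift : ∀ s {n k} → 1 ≤ k → suc k < q a (suc s) →
    FloorDivα a n k ⇔ FloorDivα a (p a s + n) (q a s + k)
  FloorDivα-shift s {n} {k} k≥1 k+1<qₛ₊₁ =
    ¬-cong-⇔ (LtMulα-shift s k≥1 (<-trans (n<1+n k) k+1<qₛ₊₁))
    ×-⇔ subst (λ m → LtMulα a n (suc k) ⇔ LtMulα a (p a s + n) m) (+-suc (q a s) k)
              (LtMulα-shift s (s≤s z≤n) k+1<qₛ₊₁)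

  InB-shift : ∀ s {j} → 1 ≤ j → suc j < q a (suc s) → InB a j ⇔ InB a (q a s + j)
  InB-shift s {j} j≥1 j+1<qₛ₊₁ = mk⇔ to from
    where
    floor-shift : ∀ {n} → FloorDivα a n j ⇔ FloorDivα a (p a s + n) (q a s + j)
    floor-shift = FloorDivα-shift s j≥1 j+1<qₛ₊₁

    to : InB a j → InB a (q a s + j)
    to (n , n≥1 , ⌊n/α⌋≡j) =
      p a s + n , ≤-trans n≥1 (m≤n+m n (p a s)) , Equivalence.to floor-shift ⌊n/α⌋≡j

    from : InB a (q a s + j) → InB a j
    from (n , _ , ⌊n/α⌋≡qₛ+j) =
      n ∸ p a s , m<n⇒0<n∸m pₛ<n ,
      Equivalence.from floor-shift
        (subst (λ m → FloorDivα a m (q a s + j)) (sym (m+[n∸m]≡n (<⇒≤ pₛ<n))) ⌊n/α⌋≡qₛ+j)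
      where
      pₛ<[qₛ+j]α : LtMulα a (p a s + 0) (q a s + j)
      pₛ<[qₛ+j]α = Equivalence.to (LtMulα-shift s j≥1 (<-trans (n<1+n j) j+1<qₛ₊₁)) (LtMulα-zero j≥1)
      pₛ<n : p a s < n
      pₛ<n = ≰⇒> λ n≤pₛ → proj₁ ⌊n/α⌋≡qₛ+j
        (LtMulα-downward {k = q a s + j} (≤-trans n≤pₛ (m≤m+n (p a s) 0)) pₛ<[qₛ+j]α)

  -- q₀ = q₁ when a₁ = 1, so the largest continuant need not have the largest index.
  maximal-continuant⇒next-exceeds : ∀ {m} t → (∀ s → q a s ≤ m → q a s ≤ q a t) →
    ∃ λ s → q a s ≡ q a t × m < q a (suc s)
  maximal-continuant⇒next-exceeds {m} t maximal with m <? q a (suc t)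
  ... | yes m<qₜ₊₁ = t , refl , m<qₜ₊₁
  maximal-continuant⇒next-exceeds (suc t) maximal | no m≮qₜ₊₂ =
    contradiction (maximal (suc (suc t)) (≮⇒≥ m≮qₜ₊₂)) (<⇒≱ (q-increasing t))
  maximal-continuant⇒next-exceeds zero maximal | no m≮q₁ =
    1 , ≤-antisym (maximal 1 (≮⇒≥ m≮q₁)) (q-pos 1) ,
    ≰⇒> (λ q₂≤m → <⇒≱ (≤-<-trans (q-pos 1) (q-increasing 0)) (maximal 2 q₂≤m))

-- The hypothesis 1 ≤ m is implied by q a t ≤ m.
lemma6 : (a : ℕ → ℕ) → (∀ i → 1 ≤ a (suc i)) →
    (m : ℕ) → 1 ≤ m →
    (t : ℕ) → q a t ≤ m → (∀ s → q a s ≤ m → q a s ≤ q a t) →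
    (j : ℕ) → 1 ≤ j → j ≤ m ∸ q a t →
    (InB a (q a t + j) → InB a j) × (InB a j → InB a (q a t + j))
lemma6 a a-pos m _ t qₜ≤m maximal j j≥1 j≤m∸qₜ =
  let s , qₛ≡qₜ , m<qₛ₊₁ = maximal-continuant⇒next-exceeds t maximal
      j+1<qₛ₊₁ = begin-strict
        1 + j               ≤⟨ +-monoˡ-≤ j (q-pos t) ⟩
        q a t + j           ≤⟨ +-monoʳ-≤ (q a t) j≤m∸qₜ ⟩
        q a t + (m ∸ q a t) ≡⟨ m+[n∸m]≡n qₜ≤m ⟩
        m                   <⟨ m<qₛ₊₁ ⟩
        q a (suc s)         ∎
      shift = subst (λ k → InB a j ⇔ InB a (k + j)) qₛ≡qₜ (InB-shift s j≥1 j+1<qₛ₊₁)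
  in Equivalence.from shift , Equivalence.to shift
  where
  open Convergents a a-pos
  open ≤-Reasoning
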